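{- Let $p$ be a prime and $r\ge1$ an integer. Let $f\in\mathbb{Q}[x]$ be a $p^r$-pure polynomial of degree $d>r$. If $g\in\mathbb{Q}[x]$ is a nonconstant $p$-type polynomial, then $f\circ g$ is $p^r$-pure.
   Context: $\nu_p$ denotes the $p$-adic valuation on $\mathbb{Q}$ (with $\nu_p(0)=\infty$). A polynomial $q(x)=a_nx^n+\dots+a_0\in\mathbb{Q}[x]$ of degree $n$ is $p^r$-pure if $\nu_p(a_n)=0$, $\nu_p(a_0)=r$, and $\frac{\nu_p(a_i)}{n-i}\ge\frac{r}{n}$ for all $1\le i\le n-1$. It is $p$-type if $\nu_p(a_n)=0$ and $\nu_p(a_i)\ge1$ for all $0\le i\le n-1$. -}

module Defs where

open import Data.Nat as ℕ using (ℕ; zero; suc)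
open import Data.Nat.Divisibility using (_∣_)
open import Data.Integer as ℤ using (ℤ; +_)
open import Data.Rational as ℚ using (ℚ; 0ℚ)
open import Data.List using (List; []; _∷_)
open import Data.Product using (Σ; ∃; _×_)
open import Data.Sum using (_⊎_)
open import Relation.Nullary using (¬_)
open import Relation.Binary.PropositionalEquality using (_≡_; _≢_)

-- Polynomials over ℚ as coefficient lists, constant term first:
-- a₀ ∷ a₁ ∷ … represents a₀ + a₁ x + …  (trailing zeros allowed).

Poly : Set
Poly = List ℚ

coeff : Poly → ℕ → ℚ
coeff []       _       = 0ℚ
coeff (a ∷ _)  zero    = a
coeff (_ ∷ as) (suc i) = coeff as i

_⊕_ : Poly → Poly → Poly
[]       ⊕ q        = q
(a ∷ as) ⊕ []       = a ∷ as
(a ∷ as) ⊕ (b ∷ bs) = (a ℚ.+ b) ∷ (as ⊕ bs)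

scale : ℚ → Poly → Poly
scale c []       = []
scale c (a ∷ as) = (c ℚ.* a) ∷ scale c as

_⊗_ : Poly → Poly → Poly
[]       ⊗ q = []
(a ∷ as) ⊗ q = scale a q ⊕ (0ℚ ∷ (as ⊗ q))

-- composition f ∘ g (Horner): (a₀ + x·h)(g) = a₀ + g·h(g)
_∘ₚ_ : Poly → Poly → Poly
[]       ∘ₚ g = []
(a ∷ as) ∘ₚ g = (a ∷ []) ⊕ (g ⊗ (as ∘ₚ g))

HasDegree : Poly → ℕ → Set
HasDegree q n = coeff q n ≢ 0ℚ × (∀ i → n ℕ.< i → coeff q i ≡ 0ℚ)

IsValℕ : ℕ → ℕ → ℕ → Set
IsValℕ p m k = (p ℕ.^ k ∣ m) × ¬ (p ℕ.^ suc k ∣ m)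

-- ν_p(a) = z for a rational a (forces a ≠ 0; ν_p(0) = ∞ has no finite value)
-- ν_p(num/den) = ν_p(num) - ν_p(den)
IsValℚ : ℕ → ℚ → ℤ → Set
IsValℚ p a z = Σ ℕ λ k → Σ ℕ λ l →
  IsValℕ p ℤ.∣ ℚ.numerator a ∣ k × IsValℕ p (ℚ.denominatorℕ a) l ×
  z ≡ (+ k) ℤ.- (+ l)

-- p^r-pure polynomial of degree n (a_i = coeff q i):
--   ν_p(a_n) = 0, ν_p(a_0) = r, and ν_p(a_i)/(n-i) ≥ r/n for 1 ≤ i ≤ n-1.
-- The last condition is cross-multiplied (n-i > 0, n > 0):  r(n-i) ≤ n ν_p(a_i),
-- and holds automatically when a_i = 0 (ν_p(0) = ∞).

IsPure : ℕ → ℕ → Poly → ℕ → Set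
IsPure p r q n =
  HasDegree q n ×
  IsValℚ p (coeff q n) (+ 0) ×
  IsValℚ p (coeff q 0) (+ r) ×
  (∀ i → 1 ℕ.≤ i → i ℕ.< n →
     coeff q i ≡ 0ℚ ⊎
     (Σ ℤ λ z → IsValℚ p (coeff q i) z × (+ r) ℤ.* (+ (n ℕ.∸ i)) ℤ.≤ (+ n) ℤ.* z))

IsPType : ℕ → Poly → ℕ → Set
IsPType p q n =
  HasDegree q n ×
  IsValℚ p (coeff q n) (+ 0) ×
  (∀ i → i ℕ.< n →
     coeff q i ≡ 0ℚ ⊎ (Σ ℤ λ z → IsValℚ p (coeff q i) z × (+ 1) ℤ.≤ z))

-- Write ν for ν_p and put the Newton diagram of a polynomial, the points (k, ν(coefficient k)),
-- against lines N·y + s·x = c. Purity of f of degree d says its diagram lies above r·x + d·y = r·d.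
-- Every coefficient b_k of g satisfies de·ν(b_k) + r·k ≥ r·e, since ν(b_k) ≥ 1 below the leading
-- term and r < d; so g^i lies above r·x + de·y = r·e·i, each a_i·g^i above r·x + de·y = r·de, and
-- so does f ∘ g, which is the middle condition of purity for the degree de. The leading coefficient
-- a_d·b_e^d is a p-adic unit. The constant term is a_0 + Σ_{i≥1} a_i·b_0^i, where every summand with
-- i ≥ 1 has valuation > r because ν(b_0) ≥ 1 and d > r; hence it has valuation exactly r.

module Submission where

open import Data.Empty using (⊥-elim)
open import Data.Integer as ℤ using (ℤ; +_; -[1+_])
import Data.Integer.Divisibility.Signed as ℤ∣
import Data.Integer.Properties as ℤP
open import Data.List using ([]; _∷_)
open import Data.Nat
  using ( ℕ; zero; suc; _+_; _*_; _∸_; _≤_; _<_; z≤n; s≤s; _^_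
        ; NonZero; ≢-nonZero; ≢-nonZero⁻¹; nonTrivial⇒≢1; nonTrivial⇒n>1)
open import Data.Nat.Coprimality using (Coprime; coprime-divisor; recompute) renaming (sym to coprime-sym)
open import Data.Nat.Divisibility
  using ( _∣_; divides; _∣?_; _∣0; 1∣_; ∣1⇒≡1; ∣-trans; ∣⇒≤; m∣m*n; n∣m*n; ∣m⇒∣m*n; m*n∣⇒m∣
        ; *-pres-∣; *-monoʳ-∣; *-cancelˡ-∣)
open import Data.Nat.Primality using (Prime; euclidsLemma; prime⇒nonZero; prime⇒nonTrivial)
open import Data.Nat.Properties
open import Data.Nat.Tactic.RingSolver using (solve-∀)
open import Data.Product using (Σ; _×_; _,_; proj₁; proj₂)
open import Data.Rational as ℚ using (ℚ; 0ℚ; 1ℚ; mkℚ; ↥_; ↧_; ↧ₙ_; toℚᵘ)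
import Data.Rational.Properties as ℚP
open import Data.Rational.Unnormalised as ℚᵘ using (*≡*)
open import Data.Sum using (_⊎_; inj₁; inj₂)
open import Function using (_∘_)
open import Relation.Binary.Definitions using (tri<; tri≈; tri>)
open import Relation.Binary.PropositionalEquality
open import Relation.Nullary using (¬_; yes; no)
open import Relation.Unary using (Decidable)
open import Defs
open import Algebra.Definitions.RawSemiring ℚ.+-*-rawSemiring using () renaming (_^_ to _^ᵠ_)

-- Degree and top coefficient of sums, products and compositions

coeff-⊕ : ∀ h₁ h₂ k → coeff (h₁ ⊕ h₂) k ≡ coeff h₁ k ℚ.+ coeff h₂ k
coeff-⊕ []       h₂       k       = sym (ℚP.+-identityˡ _)
coeff-⊕ (a ∷ as) []       k       = sym (ℚP.+-identityʳ _)
coeff-⊕ (a ∷ as) (b ∷ bs) zero    = refl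
coeff-⊕ (a ∷ as) (b ∷ bs) (suc k) = coeff-⊕ as bs k

coeff-scale : ∀ c h k → coeff (scale c h) k ≡ c ℚ.* coeff h k
coeff-scale c []       k       = sym (ℚP.*-zeroʳ c)
coeff-scale c (a ∷ as) zero    = refl
coeff-scale c (a ∷ as) (suc k) = coeff-scale c as k

AllZero : Poly → Set
AllZero h = ∀ i → coeff h i ≡ 0ℚ

AllZero-⊕ : ∀ h₁ h₂ → AllZero h₁ → AllZero h₂ → AllZero (h₁ ⊕ h₂)
AllZero-⊕ h₁ h₂ z₁ z₂ i = begin
  coeff (h₁ ⊕ h₂) i            ≡⟨ coeff-⊕ h₁ h₂ i ⟩
  coeff h₁ i ℚ.+ coeff h₂ i    ≡⟨ cong₂ ℚ._+_ (z₁ i) (z₂ i) ⟩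
  0ℚ                           ∎
  where open ≡-Reasoning

AllZero-scaleʳ : ∀ a h → AllZero h → AllZero (scale a h)
AllZero-scaleʳ a h z i = trans (coeff-scale a h i) (trans (cong (a ℚ.*_) (z i)) (ℚP.*-zeroʳ a))

AllZero-scaleˡ : ∀ {a} h → a ≡ 0ℚ → AllZero (scale a h)
AllZero-scaleˡ {a} h refl i = trans (coeff-scale 0ℚ h i) (ℚP.*-zeroˡ (coeff h i))

AllZero-shift : ∀ h → AllZero h → AllZero (0ℚ ∷ h)
AllZero-shift h z zero    = refl
AllZero-shift h z (suc i) = z i

AllZero-⊗ˡ : ∀ h₁ h₂ → AllZero h₁ → AllZero (h₁ ⊗ h₂)
AllZero-⊗ˡ []       h₂ z = λ _ → refl
AllZero-⊗ˡ (a ∷ as) h₂ z =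
  AllZero-⊕ (scale a h₂) (0ℚ ∷ (as ⊗ h₂)) (AllZero-scaleˡ h₂ (z 0))
    (AllZero-shift (as ⊗ h₂) (AllZero-⊗ˡ as h₂ (λ i → z (suc i))))

AllZero-⊗ʳ : ∀ h₁ h₂ → AllZero h₂ → AllZero (h₁ ⊗ h₂)
AllZero-⊗ʳ []       h₂ z = λ _ → refl
AllZero-⊗ʳ (a ∷ as) h₂ z = AllZero-⊕ (scale a h₂) (0ℚ ∷ (as ⊗ h₂)) (AllZero-scaleʳ a h₂ z)
    (AllZero-shift (as ⊗ h₂) (AllZero-⊗ʳ as h₂ z))

AllZero-∘ : ∀ f g → AllZero f → AllZero (f ∘ₚ g)
AllZero-∘ []       g z = λ _ → refl
AllZero-∘ (a ∷ as) g z =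
  AllZero-⊕ (a ∷ []) (g ⊗ (as ∘ₚ g)) const (AllZero-⊗ʳ g (as ∘ₚ g) (AllZero-∘ as g (λ i → z (suc i))))
  where
  const : AllZero (a ∷ [])
  const zero    = z 0
  const (suc i) = refl

record TopCoeff (h : Poly) (n : ℕ) (c : ℚ) : Set where
  constructor topCoeff
  field
    coeff-top   : coeff h n ≡ c
    coeff-above : ∀ i → n < i → coeff h i ≡ 0ℚ
open TopCoeff

TopCoeff-resp : ∀ {h n c c′} → c ≡ c′ → TopCoeff h n c → TopCoeff h n c′
TopCoeff-resp refl t = t

TopCoeff-raise : ∀ {h n c k} → n < k → TopCoeff h n c → TopCoeff h k 0ℚ
TopCoeff-raise n<k (topCoeff _ above) = topCoeff (above _ n<k) (λ i k<i → above i (<-trans n<k k<i))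

AllZero⇒TopCoeff : ∀ {h} n → AllZero h → TopCoeff h n 0ℚ
AllZero⇒TopCoeff n z = topCoeff (z n) (λ i _ → z i)

TopCoeff-[_] : ∀ a → TopCoeff (a ∷ []) 0 a
TopCoeff-[ a ] = topCoeff refl λ { zero () ; (suc i) _ → refl }

TopCoeff-tail : ∀ {a as n c} → TopCoeff (a ∷ as) (suc n) c → TopCoeff as n c
TopCoeff-tail (topCoeff top above) = topCoeff top (λ i n<i → above (suc i) (s≤s n<i))

TopCoeff₀⇒AllZero-tail : ∀ {a as c} → TopCoeff (a ∷ as) 0 c → AllZero as
TopCoeff₀⇒AllZero-tail t i = coeff-above t (suc i) (s≤s z≤n)

TopCoeff-shift : ∀ {h n c} → TopCoeff h n c → TopCoeff (0ℚ ∷ h) (suc n) c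
TopCoeff-shift (topCoeff top above) = topCoeff top λ { zero () ; (suc i) (s≤s n<i) → above i n<i }

TopCoeff-⊕ : ∀ h₁ h₂ {n c₁ c₂} → TopCoeff h₁ n c₁ → TopCoeff h₂ n c₂ →
             TopCoeff (h₁ ⊕ h₂) n (c₁ ℚ.+ c₂)
TopCoeff-⊕ h₁ h₂ {n} (topCoeff top₁ above₁) (topCoeff top₂ above₂) = topCoeff
  (trans (coeff-⊕ h₁ h₂ n) (cong₂ ℚ._+_ top₁ top₂))
  (λ i n<i → trans (coeff-⊕ h₁ h₂ i) (cong₂ ℚ._+_ (above₁ i n<i) (above₂ i n<i)))

TopCoeff-scale : ∀ a h {n c} → TopCoeff h n c → TopCoeff (scale a h) n (a ℚ.* c)
TopCoeff-scale a h {n} (topCoeff top above) = topCoeff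
  (trans (coeff-scale a h n) (cong (a ℚ.*_) top))
  (λ i n<i → trans (coeff-scale a h i) (trans (cong (a ℚ.*_) (above i n<i)) (ℚP.*-zeroʳ a)))

TopCoeff-⊗ : ∀ h₁ h₂ {n m c₁ c₂} → TopCoeff h₁ n c₁ → TopCoeff h₂ m c₂ →
             TopCoeff (h₁ ⊗ h₂) (n + m) (c₁ ℚ.* c₂)
TopCoeff-⊗ [] h₂ {c₂ = c₂} t₁ t₂ =
  topCoeff (trans (sym (ℚP.*-zeroˡ c₂)) (cong (ℚ._* c₂) (coeff-top t₁))) (λ _ _ → refl)
TopCoeff-⊗ (a ∷ as) h₂ {zero} {m} {c₁} {c₂} t₁ t₂ =
  TopCoeff-resp (trans (ℚP.+-identityʳ _) (cong (ℚ._* c₂) (coeff-top t₁)))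
    (TopCoeff-⊕ (scale a h₂) (0ℚ ∷ (as ⊗ h₂)) (TopCoeff-scale a h₂ t₂)
      (AllZero⇒TopCoeff m (AllZero-shift (as ⊗ h₂) (AllZero-⊗ˡ as h₂ (TopCoeff₀⇒AllZero-tail t₁)))))
TopCoeff-⊗ (a ∷ as) h₂ {suc n} {m} t₁ t₂ =
  TopCoeff-resp (ℚP.+-identityˡ _)
    (TopCoeff-⊕ (scale a h₂) (0ℚ ∷ (as ⊗ h₂))
      (TopCoeff-raise (s≤s (m≤n+m m n)) (TopCoeff-scale a h₂ t₂))
      (TopCoeff-shift (TopCoeff-⊗ as h₂ (TopCoeff-tail t₁) t₂)))

TopCoeff-∘ : ∀ f g {d e a b} → 0 < e → TopCoeff f d a → TopCoeff g e b →
             TopCoeff (f ∘ₚ g) (d * e) (a ℚ.* b ^ᵠ d)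
TopCoeff-∘ [] g {d} {b = b} _ t₁ _ =
  topCoeff (trans (sym (ℚP.*-zeroˡ (b ^ᵠ d))) (cong (ℚ._* b ^ᵠ d) (coeff-top t₁))) (λ _ _ → refl)
TopCoeff-∘ (a ∷ as) g {zero} {a = c} 0<e t₁ t₂ =
  TopCoeff-resp (trans (ℚP.+-identityʳ _) (trans (coeff-top t₁) (sym (ℚP.*-identityʳ c))))
    (TopCoeff-⊕ (a ∷ []) (g ⊗ (as ∘ₚ g)) TopCoeff-[ a ]
      (AllZero⇒TopCoeff 0 (AllZero-⊗ʳ g (as ∘ₚ g) (AllZero-∘ as g (TopCoeff₀⇒AllZero-tail t₁)))))
TopCoeff-∘ (a ∷ as) g {suc d} {e} {c} {b} 0<e t₁ t₂ =
  TopCoeff-resp (trans (ℚP.+-identityˡ _) (swap b c (b ^ᵠ d)))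
    (TopCoeff-⊕ (a ∷ []) (g ⊗ (as ∘ₚ g))
      (TopCoeff-raise (≤-trans 0<e (m≤m+n e (d * e))) TopCoeff-[ a ])
      (TopCoeff-⊗ g (as ∘ₚ g) t₂ (TopCoeff-∘ as g 0<e (TopCoeff-tail t₁) t₂)))
  where
  swap : ∀ x y z → x ℚ.* (y ℚ.* z) ≡ y ℚ.* (x ℚ.* z)
  swap x y z = trans (sym (ℚP.*-assoc x y z)) (trans (cong (ℚ._* z) (ℚP.*-comm x y)) (ℚP.*-assoc y x z))

HasDegree⇒TopCoeff : ∀ {h n} → HasDegree h n → TopCoeff h n (coeff h n)
HasDegree⇒TopCoeff (_ , above) = topCoeff refl above

-- Lower bounds for the p-adic valuation on ℚ

num : ℚ → ℕ
num a = ℤ.∣ ↥ a ∣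

num-coprime-den : ∀ a → Coprime (num a) (↧ₙ a)
num-coprime-den (mkℚ _ _ c) = recompute c

private
  toℚᵘ-cross : ∀ a b → toℚᵘ a ℚᵘ.≃ b → ↥ a ℤ.* ℚᵘ.↧ b ≡ ℚᵘ.↥ b ℤ.* ↧ a
  toℚᵘ-cross (mkℚ _ _ _) b (*≡* eq) = eq

  ∣∣-cross : ∀ {x y : ℤ} {m n : ℕ} → x ℤ.* + m ≡ y ℤ.* + n → ℤ.∣ x ∣ * m ≡ ℤ.∣ y ∣ * n
  ∣∣-cross {x} {y} {m} {n} eq = trans (sym (ℤP.abs-* x (+ m))) (trans (cong ℤ.∣_∣ eq) (ℤP.abs-* y (+ n)))

num-*-cross : ∀ a b → num (a ℚ.* b) * (↧ₙ a * ↧ₙ b) ≡ (num a * num b) * ↧ₙ (a ℚ.* b)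
num-*-cross a@(mkℚ _ _ _) b@(mkℚ _ _ _) =
  trans (∣∣-cross {↥ (a ℚ.* b)} {↥ a ℤ.* ↥ b} {↧ₙ a * ↧ₙ b} {↧ₙ (a ℚ.* b)}
           (toℚᵘ-cross (a ℚ.* b) _ (ℚP.toℚᵘ-homo-* a b)))
        (cong (_* ↧ₙ (a ℚ.* b)) (ℤP.abs-* (↥ a) (↥ b)))

num-+-cross : ∀ a b →
  num (a ℚ.+ b) * (↧ₙ a * ↧ₙ b) ≡ ℤ.∣ ↥ a ℤ.* ↧ b ℤ.+ ↥ b ℤ.* ↧ a ∣ * ↧ₙ (a ℚ.+ b)
num-+-cross a@(mkℚ _ _ _) b@(mkℚ _ _ _) =
  ∣∣-cross {↥ (a ℚ.+ b)} {↥ a ℤ.* ↧ b ℤ.+ ↥ b ℤ.* ↧ a} {↧ₙ a * ↧ₙ b} {↧ₙ (a ℚ.+ b)}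
    (toℚᵘ-cross (a ℚ.+ b) _ (ℚP.toℚᵘ-homo-+ a b))

lastSatisfying : ∀ {P : ℕ → Set} → Decidable P → ∀ {m} b → P m → ¬ P (m + b) →
                 Σ ℕ λ v → m ≤ v × P v × ¬ P (suc v)
lastSatisfying {P} P? {m} zero    Pm ¬P = ⊥-elim (¬P (subst P (sym (+-identityʳ m)) Pm))
lastSatisfying {P} P? {m} (suc b) Pm ¬P with P? (suc m)
... | no ¬Psm = m , ≤-refl , Pm , ¬Psm
... | yes Psm =
  let v , sm≤v , Pv , ¬Psv = lastSatisfying P? b Psm (¬P ∘ subst P (sym (+-suc m b)))
  in  v , ≤-trans (n≤1+n m) sm≤v , Pv , ¬Psv

ℤ-bound⇒ℕ : ∀ {a d} z .{{_ : NonZero d}} → + a ℤ.≤ + d ℤ.* z →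
            Σ ℕ λ m → z ≡ + m × a ≤ d * m
ℤ-bound⇒ℕ {d = zero}  _ _ = ⊥-elim (≢-nonZero⁻¹ 0 refl)
ℤ-bound⇒ℕ {a} {suc d} (+ m) le =
  m , refl , ℤP.drop‿+≤+ (subst (+ a ℤ.≤_) (sym (ℤP.pos-* (suc d) m)) le)
ℤ-bound⇒ℕ {d = suc d} -[1+ k ] ()

module _ {p : ℕ} (p-prime : Prime p) where

  private instance
    p-nonZero : NonZero p
    p-nonZero = prime⇒nonZero p-prime

  p≢1 : p ≢ 1
  p≢1 = nonTrivial⇒≢1 {{prime⇒nonTrivial p-prime}}

  p∤1 : ¬ p ∣ 1
  p∤1 = p≢1 ∘ ∣1⇒≡1

  p∤* : ∀ {m n} → ¬ p ∣ m → ¬ p ∣ n → ¬ p ∣ m * n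
  p∤* {m} {n} p∤m p∤n p∣mn with euclidsLemma m n p-prime p∣mn
  ... | inj₁ p∣m = p∤m p∣m
  ... | inj₂ p∣n = p∤n p∣n

  p^k∣*-cancelʳ : ∀ k {m D} → ¬ p ∣ D → p ^ k ∣ m * D → p ^ k ∣ m
  p^k∣*-cancelʳ zero    _   _ = 1∣ _
  p^k∣*-cancelʳ (suc k) {m} {D} p∤D p^k+1∣mD with euclidsLemma m D p-prime (m*n∣⇒m∣ p (p ^ k) p^k+1∣mD)
  ... | inj₂ p∣D = ⊥-elim (p∤D p∣D)
  ... | inj₁ (divides q refl) =
    subst (p * p ^ k ∣_) (*-comm p q) (*-monoʳ-∣ p (p^k∣*-cancelʳ k p∤D (*-cancelˡ-∣ p p·p^k∣p·qD)))
    where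
    p·p^k∣p·qD : p * p ^ k ∣ p * (q * D)
    p·p^k∣p·qD = subst (p * p ^ k ∣_) (trans (cong (_* D) (*-comm q p)) (*-assoc p q D)) p^k+1∣mD

  n<p^n : ∀ n → n < p ^ n
  n<p^n zero    = s≤s z≤n
  n<p^n (suc n) = begin-strict
    suc n             ≤⟨ n<p^n n ⟩
    p ^ n             <⟨ m<m+n (p ^ n) (m^n>0 p n) ⟩
    p ^ n + p ^ n     ≡⟨ cong (_+_ (p ^ n)) (sym (+-identityʳ (p ^ n))) ⟩
    2 * p ^ n         ≤⟨ *-monoˡ-≤ (p ^ n) (nonTrivial⇒n>1 p {{prime⇒nonTrivial p-prime}}) ⟩
    p * p ^ n         ∎
    where open ≤-Reasoning

  -- ν_p(a) ≥ k, with ν_p(0) = ∞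
  record ValAtLeast (a : ℚ) (k : ℕ) : Set where
    constructor valAtLeast
    field
      p^k∣num : p ^ k ∣ num a
      p∤den   : ¬ p ∣ ↧ₙ a

  -- In the next two lemmas ∣a∣ = N / D, a possibly unreduced fraction.
  fraction-ValAtLeast : ∀ a {N D k} → num a * D ≡ N * ↧ₙ a → p ^ k ∣ N → ¬ p ∣ D → ValAtLeast a k
  fraction-ValAtLeast a {N} {D} {k} eq p^k∣N p∤D = valAtLeast
    (p^k∣*-cancelʳ k p∤D (subst (p ^ k ∣_) (sym eq) (∣m⇒∣m*n (↧ₙ a) p^k∣N)))
    (p∤D ∘ (λ p∣den → ∣-trans p∣den den∣D))
    where
    den∣D : ↧ₙ a ∣ D
    den∣D = coprime-divisor (coprime-sym (num-coprime-den a)) (subst (↧ₙ a ∣_) (sym eq) (n∣m*n N))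

  fraction-p∤num : ∀ a {N D} → num a * D ≡ N * ↧ₙ a → ¬ p ∣ N → ¬ p ∣ num a
  fraction-p∤num a {N} {D} eq p∤N p∣num = p∤N (∣-trans p∣num num∣N)
    where
    num∣N : num a ∣ N
    num∣N = coprime-divisor (num-coprime-den a) (subst (num a ∣_) (trans eq (*-comm N (↧ₙ a))) (m∣m*n D))

  ValAtLeast-0ℚ : ∀ k → ValAtLeast 0ℚ k
  ValAtLeast-0ℚ k = valAtLeast ((p ^ k) ∣0) p∤1

  ValAtLeast-≤ : ∀ {a k l} → k ≤ l → ValAtLeast a l → ValAtLeast a k
  ValAtLeast-≤ {k = k} {l} k≤l (valAtLeast p^l∣num p∤den) = valAtLeast (∣-trans p^k∣p^l p^l∣num) p∤den
    where
    p^k∣p^l : p ^ k ∣ p ^ l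
    p^k∣p^l = subst (p ^ k ∣_) (trans (sym (^-distribˡ-+-* p k (l ∸ k))) (cong (p ^_) (m+[n∸m]≡n k≤l)))
                (m∣m*n (p ^ (l ∸ k)))

  ValAtLeast-* : ∀ {a b k l} → ValAtLeast a k → ValAtLeast b l → ValAtLeast (a ℚ.* b) (k + l)
  ValAtLeast-* {a} {b} {k} {l} (valAtLeast ka da) (valAtLeast kb db) =
    fraction-ValAtLeast (a ℚ.* b) (num-*-cross a b)
      (subst (_∣ num a * num b) (sym (^-distribˡ-+-* p k l)) (*-pres-∣ ka kb)) (p∤* da db)

  ValAtLeast-+ : ∀ {a b k} → ValAtLeast a k → ValAtLeast b k → ValAtLeast (a ℚ.+ b) k
  ValAtLeast-+ {a} {b} {k} (valAtLeast ka da) (valAtLeast kb db) =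
    fraction-ValAtLeast (a ℚ.+ b) (num-+-cross a b)
      (ℤ∣.∣⇒∣ᵤ (ℤ∣.∣m∣n⇒∣m+n (ℤ∣.∣m⇒∣m*n (↧ b) (ℤ∣.∣ᵤ⇒∣ {+ (p ^ k)} {↥ a} ka))
                             (ℤ∣.∣m⇒∣m*n (↧ a) (ℤ∣.∣ᵤ⇒∣ {+ (p ^ k)} {↥ b} kb))))
      (p∤* da db)

  ValAtLeast-neg : ∀ {a k} → ValAtLeast a k → ValAtLeast (ℚ.- a) k
  ValAtLeast-neg {a} {k} (valAtLeast ka da) = valAtLeast
    (subst (p ^ k ∣_) (sym (trans (cong ℤ.∣_∣ (ℚP.↥-neg a)) (ℤP.∣-i∣≡∣i∣ (↥ a)))) ka)
    (subst (λ t → ¬ p ∣ t) (sym (cong ℤ.∣_∣ (ℚP.↧-neg a))) da)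

  IsValℚ⇒exact : ∀ a {k} → IsValℚ p a (+ k) → ValAtLeast a k × ¬ ValAtLeast a (suc k)
  IsValℚ⇒exact _ (_ , zero , (p^k∣num , p^k+1∤num) , (_ , p∤den) , eq)
    with ℤP.+-injective (trans eq (ℤP.+-identityʳ _))
  ... | refl = valAtLeast p^k∣num (p∤den ∘ subst (_∣ _) (sym (*-identityʳ p))) ,
               p^k+1∤num ∘ ValAtLeast.p^k∣num
  IsValℚ⇒exact _ (zero , suc l , _ , _ , ())
  IsValℚ⇒exact a (suc k , suc l , (p^k+1∣num , _) , (p^l+1∣den , _) , _) =
    ⊥-elim (p≢1 (num-coprime-den a (m*n∣⇒m∣ p (p ^ k) p^k+1∣num , m*n∣⇒m∣ p (p ^ l) p^l+1∣den)))

  exact⇒IsValℚ : ∀ {a k} → ValAtLeast a k → ¬ ValAtLeast a (suc k) → IsValℚ p a (+ k)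
  exact⇒IsValℚ {k = k} (valAtLeast p^k∣num p∤den) ¬k+1 =
    k , 0 , (p^k∣num , ¬k+1 ∘ (λ p^k+1∣num → valAtLeast p^k+1∣num p∤den)) ,
    (1∣ _ , p∤den ∘ subst (_∣ _) (*-identityʳ p)) , sym (ℤP.+-identityʳ (+ k))

  IsValℚ⇒ValAtLeast : ∀ a {k} → IsValℚ p a (+ k) → ValAtLeast a k
  IsValℚ⇒ValAtLeast a = proj₁ ∘ IsValℚ⇒exact a

  IsValℚ⇒≢0 : ∀ a {z} → IsValℚ p a z → a ≢ 0ℚ
  IsValℚ⇒≢0 _ (k , _ , (_ , p^k+1∤num) , _) refl = p^k+1∤num ((p ^ suc k) ∣0)

  ValAtLeast⇒IsValℚ : ∀ {a m} → a ≢ 0ℚ → ValAtLeast a m → Σ ℕ λ v → m ≤ v × IsValℚ p a (+ v)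
  ValAtLeast⇒IsValℚ {a} {m} a≢0 (valAtLeast p^m∣num p∤den)
    with lastSatisfying (λ v → p ^ v ∣? num a) (num a) p^m∣num p^[m+num]∤num
    where
    p^[m+num]∤num : ¬ p ^ (m + num a) ∣ num a
    p^[m+num]∤num p^[m+num]∣num = <⇒≱ (n<p^n (num a)) (begin
      p ^ num a        ≤⟨ ^-monoʳ-≤ p (m≤n+m (num a) m) ⟩
      p ^ (m + num a)  ≤⟨ ∣⇒≤ {{≢-nonZero num≢0}} p^[m+num]∣num ⟩
      num a            ∎)
      where
      open ≤-Reasoning
      num≢0 : num a ≢ 0
      num≢0 = a≢0 ∘ ℚP.↥p≡0⇒p≡0 a ∘ ℤP.∣i∣≡0⇒i≡0
  ... | v , m≤v , p^v∣num , p^v+1∤num =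
    v , m≤v , exact⇒IsValℚ {a} (valAtLeast p^v∣num p∤den) (p^v+1∤num ∘ ValAtLeast.p^k∣num)

  IsValℚ-1ℚ : IsValℚ p 1ℚ (+ 0)
  IsValℚ-1ℚ =
    exact⇒IsValℚ {1ℚ} (valAtLeast (1∣ 1) p∤1) (p∤1 ∘ subst (_∣ 1) (*-identityʳ p) ∘ ValAtLeast.p^k∣num)

  unit⇒p∤num : ∀ a → IsValℚ p a (+ 0) → ¬ p ∣ num a
  unit⇒p∤num a v p∣num with IsValℚ⇒exact a v
  ... | valAtLeast _ p∤den , ¬val≥1 =
    ¬val≥1 (valAtLeast (subst (_∣ _) (sym (*-identityʳ p)) p∣num) p∤den)

  IsValℚ-unit-* : ∀ a b → IsValℚ p a (+ 0) → IsValℚ p b (+ 0) → IsValℚ p (a ℚ.* b) (+ 0)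
  IsValℚ-unit-* a b va vb = exact⇒IsValℚ (ValAtLeast-* (IsValℚ⇒ValAtLeast a va) (IsValℚ⇒ValAtLeast b vb))
    λ val≥1 → fraction-p∤num (a ℚ.* b) (num-*-cross a b) (p∤* (unit⇒p∤num a va) (unit⇒p∤num b vb))
                (subst (_∣ _) (*-identityʳ p) (ValAtLeast.p^k∣num val≥1))

  IsValℚ-unit-^ : ∀ a → IsValℚ p a (+ 0) → ∀ n → IsValℚ p (a ^ᵠ n) (+ 0)
  IsValℚ-unit-^ a va zero    = IsValℚ-1ℚ
  IsValℚ-unit-^ a va (suc n) = IsValℚ-unit-* a (a ^ᵠ n) va (IsValℚ-unit-^ a va n)

  IsValℚ-+-dominant : ∀ a {b k} → IsValℚ p a (+ k) → ValAtLeast b (suc k) → IsValℚ p (a ℚ.+ b) (+ k)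
  IsValℚ-+-dominant a {b} {k} va b≥k+1 with IsValℚ⇒exact a va
  ... | a≥k , ¬a≥k+1 = exact⇒IsValℚ (ValAtLeast-+ a≥k (ValAtLeast-≤ (n≤1+n k) b≥k+1))
    λ a+b≥k+1 → ¬a≥k+1 (subst (λ t → ValAtLeast t (suc k)) (a+b-b≡a a b)
                           (ValAtLeast-+ a+b≥k+1 (ValAtLeast-neg b≥k+1)))
    where
    a+b-b≡a : ∀ a b → (a ℚ.+ b) ℚ.- b ≡ a
    a+b-b≡a a b =
      trans (ℚP.+-assoc a b (ℚ.- b)) (trans (cong (a ℚ.+_) (ℚP.+-inverseʳ b)) (ℚP.+-identityʳ a))

  -- The point (k, ν_p(a)) lies on or above the line N·y + s·x = c.
  record LiesAbove (N s c : ℕ) (a : ℚ) (k : ℕ) : Set where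
    constructor liesAbove
    field
      height  : ℕ
      val≥    : ValAtLeast a height
      line≤   : c ≤ N * height + s * k

  AboveLine : (N s c : ℕ) → Poly → Set
  AboveLine N s c h = ∀ k → LiesAbove N s c (coeff h k) k

  LiesAbove-0ℚ : ∀ {N} .{{_ : NonZero N}} s c k → LiesAbove N s c 0ℚ k
  LiesAbove-0ℚ {N} s c k = liesAbove c (ValAtLeast-0ℚ c) (≤-trans (m≤n*m c N) (m≤m+n (N * c) (s * k)))

  LiesAbove-resp : ∀ {N s c a b k} → a ≡ b → LiesAbove N s c a k → LiesAbove N s c b k
  LiesAbove-resp refl l = l

  line≤₀ : ∀ {N s c a} → (l : LiesAbove N s c a 0) → c ≤ N * LiesAbove.height l
  line≤₀ {N} {s} {c} (liesAbove m _ le) =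
    subst (c ≤_) (trans (cong (_+_ (N * m)) (*-zeroʳ s)) (+-identityʳ (N * m))) le

  AboveLine-weaken : ∀ {N s c c′} h → c′ ≤ c → AboveLine N s c h → AboveLine N s c′ h
  AboveLine-weaken h c′≤c above k with above k
  ... | liesAbove m val le = liesAbove m val (≤-trans c′≤c le)

  AboveLine-steeper : ∀ {N s s′ c} h → s ≤ s′ → AboveLine N s c h → AboveLine N s′ c h
  AboveLine-steeper {N} h s≤s′ above k with above k
  ... | liesAbove m val le = liesAbove m val (≤-trans le (+-monoʳ-≤ (N * m) (*-monoˡ-≤ k s≤s′)))

  AboveLine-rescale : ∀ {N s c} h e → AboveLine N s c h → AboveLine (N * e) (s * e) (c * e) h
  AboveLine-rescale {N} {s} h e above k with above k
  ... | liesAbove m val le = liesAbove m val (≤-trans (*-monoˡ-≤ e le) (≤-reflexive (distrib N s m k e)))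
    where
    distrib : ∀ N s m k e → (N * m + s * k) * e ≡ N * e * m + s * e * k
    distrib = solve-∀

  AboveLine-⊕ : ∀ {N s c} h₁ h₂ → AboveLine N s c h₁ → AboveLine N s c h₂ →
                AboveLine N s c (h₁ ⊕ h₂)
  AboveLine-⊕ h₁ h₂ above₁ above₂ k with above₁ k | above₂ k
  ... | liesAbove m₁ val₁ le₁ | liesAbove m₂ val₂ le₂ = LiesAbove-resp (sym (coeff-⊕ h₁ h₂ k)) sum
    where
    sum : LiesAbove _ _ _ (coeff h₁ k ℚ.+ coeff h₂ k) k
    sum with ≤-total m₁ m₂
    ... | inj₁ m₁≤m₂ = liesAbove m₁ (ValAtLeast-+ val₁ (ValAtLeast-≤ m₁≤m₂ val₂)) le₁
    ... | inj₂ m₂≤m₁ = liesAbove m₂ (ValAtLeast-+ (ValAtLeast-≤ m₂≤m₁ val₁) val₂) le₂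

  AboveLine-scale : ∀ {N s c m} a h → ValAtLeast a m → AboveLine N s c h → AboveLine N s (N * m + c) (scale a h)
  AboveLine-scale {N} {s} {c} {m} a h a≥m above k with above k
  ... | liesAbove m′ val le = LiesAbove-resp (sym (coeff-scale a h k))
    (liesAbove (m + m′) (ValAtLeast-* a≥m val) (begin
      N * m + c                    ≤⟨ +-monoʳ-≤ (N * m) le ⟩
      N * m + (N * m′ + s * k)     ≡⟨ distrib N m m′ s k ⟩
      N * (m + m′) + s * k         ∎))
    where
    open ≤-Reasoning
    distrib : ∀ N m m′ s k → N * m + (N * m′ + s * k) ≡ N * (m + m′) + s * k
    distrib = solve-∀

  AboveLine-shift : ∀ {N s c} .{{_ : NonZero N}} h → AboveLine N s c h → AboveLine N s (c + s) (0ℚ ∷ h)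
  AboveLine-shift {s = s} {c} h above zero    = LiesAbove-0ℚ s (c + s) 0
  AboveLine-shift {N} {s} {c} h above (suc k) with above k
  ... | liesAbove m val le = liesAbove m val (≤-trans (+-monoˡ-≤ s le) (≤-reflexive (distrib N m s k)))
    where
    distrib : ∀ N m s k → N * m + s * k + s ≡ N * m + s * suc k
    distrib = solve-∀

  AboveLine-tail : ∀ {N s c a} as → AboveLine N s c (a ∷ as) → AboveLine N s (c ∸ s) as
  AboveLine-tail {N} {s} {c} as above k with above (suc k)
  ... | liesAbove m val le = liesAbove m val (begin
      c ∸ s                          ≤⟨ ∸-monoˡ-≤ s le ⟩
      N * m + s * suc k ∸ s          ≡⟨ cong (_∸ s) (distrib N m s k) ⟩
      N * m + s * k + s ∸ s          ≡⟨ m+n∸n≡m (N * m + s * k) s ⟩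
      N * m + s * k                  ∎)
    where
    open ≤-Reasoning
    distrib : ∀ N m s k → N * m + s * suc k ≡ N * m + s * k + s
    distrib = solve-∀

  AboveLine-head : ∀ {N s t c} .{{_ : NonZero N}} a as → AboveLine N t c (a ∷ as) → AboveLine N s c (a ∷ [])
  AboveLine-head {N} {s} a as above zero with above 0
  ... | l@(liesAbove m val _) = liesAbove m val (≤-trans (line≤₀ l) (m≤m+n (N * m) (s * 0)))
  AboveLine-head {s = s} {c = c} a as above (suc k) = LiesAbove-0ℚ s c (suc k)

  AboveLine-⊗ : ∀ {N s c₁ c₂} .{{_ : NonZero N}} h₁ h₂ →
                AboveLine N s c₁ h₁ → AboveLine N s c₂ h₂ → AboveLine N s (c₁ + c₂) (h₁ ⊗ h₂)
  AboveLine-⊗ {s = s} {c₁} {c₂} []       h₂ above₁ above₂ k = LiesAbove-0ℚ s (c₁ + c₂) k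
  AboveLine-⊗ {N} {s} {c₁} {c₂} (a ∷ as) h₂ above₁ above₂ =
    AboveLine-⊕ (scale a h₂) (0ℚ ∷ (as ⊗ h₂))
      (AboveLine-weaken (scale a h₂) (+-monoˡ-≤ c₂ c₁≤Nm) (AboveLine-scale a h₂ a≥m above₂))
      (AboveLine-weaken (0ℚ ∷ (as ⊗ h₂)) c₁+c₂≤
        (AboveLine-shift (as ⊗ h₂) (AboveLine-⊗ as h₂ (AboveLine-tail as above₁) above₂)))
    where
    open LiesAbove (above₁ 0) renaming (height to m; val≥ to a≥m)
    c₁≤Nm : c₁ ≤ N * m
    c₁≤Nm = line≤₀ (above₁ 0)
    c₁+c₂≤ : c₁ + c₂ ≤ c₁ ∸ s + c₂ + s
    c₁+c₂≤ = ≤-trans (+-monoˡ-≤ c₂ (m≤n+m∸n c₁ s)) (≤-reflexive (rearrange s (c₁ ∸ s) c₂))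
      where
      rearrange : ∀ s x c₂ → s + x + c₂ ≡ x + c₂ + s
      rearrange = solve-∀

  AboveLine-∘ : ∀ {N s t c} .{{_ : NonZero N}} f g → AboveLine N s t g → AboveLine N t c f →
                AboveLine N s c (f ∘ₚ g)
  AboveLine-∘ {s = s} {c = c} []       g aboveG aboveF k = LiesAbove-0ℚ s c k
  AboveLine-∘ {t = t} {c} (a ∷ as) g aboveG aboveF =
    AboveLine-⊕ (a ∷ []) (g ⊗ (as ∘ₚ g)) (AboveLine-head a as aboveF)
      (AboveLine-weaken (g ⊗ (as ∘ₚ g)) (m≤n+m∸n c t)
        (AboveLine-⊗ g (as ∘ₚ g) aboveG (AboveLine-∘ as g aboveG (AboveLine-tail as aboveF))))

  AboveLine⇒ValAtLeast₀ : ∀ {N s c k} h → AboveLine N s c h → N * k < c → ValAtLeast (coeff h 0) (suc k)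
  AboveLine⇒ValAtLeast₀ {N} {k = k} h above Nk<c with above 0
  ... | l@(liesAbove m val _) = ValAtLeast-≤ (*-cancelˡ-< N k m (<-≤-trans Nk<c (line≤₀ l))) val

  -- Pure and p-type polynomials, and their composition

  LiesAbove-pure : ∀ {r d a m} i → IsValℚ p a (+ m) → r * (d ∸ i) ≤ d * m → LiesAbove d r (r * d) a i
  LiesAbove-pure {r} {d} {a} {m} i v le = liesAbove m (IsValℚ⇒ValAtLeast a v) (begin
    r * d                     ≤⟨ *-monoʳ-≤ r (m≤n+m∸n d i) ⟩
    r * (i + (d ∸ i))         ≡⟨ *-distribˡ-+ r i (d ∸ i) ⟩
    r * i + r * (d ∸ i)       ≡⟨ +-comm (r * i) (r * (d ∸ i)) ⟩
    r * (d ∸ i) + r * i       ≤⟨ +-monoˡ-≤ (r * i) le ⟩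
    d * m + r * i             ∎)
    where open ≤-Reasoning

  pure⇒AboveLine : ∀ {r d} f .{{_ : NonZero d}} → IsPure p r f d → AboveLine d r (r * d) f
  pure⇒AboveLine {r} {d} f (degree , lead , const , middle) = above
    where
    above : AboveLine d r (r * d) f
    above zero = LiesAbove-pure 0 const (≤-reflexive (*-comm r d))
    above (suc i) with <-cmp (suc i) d
    ... | tri≈ _ refl _ =
      LiesAbove-pure (suc i) lead
        (≤-reflexive (trans (cong (r *_) (n∸n≡0 (suc i))) (trans (*-zeroʳ r) (sym (*-zeroʳ d)))))
    ... | tri> _ _ d<i = LiesAbove-resp (sym (proj₂ degree (suc i) d<i)) (LiesAbove-0ℚ r (r * d) (suc i))
    ... | tri< i<d _ _ with middle (suc i) (s≤s z≤n) i<d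
    ...   | inj₁ aᵢ≡0 = LiesAbove-resp (sym aᵢ≡0) (LiesAbove-0ℚ r (r * d) (suc i))
    ...   | inj₂ (z , v , le)
          with ℤ-bound⇒ℕ z (subst (ℤ._≤ + d ℤ.* z) (sym (ℤP.pos-* r (d ∸ suc i))) le)
    ...     | m , refl , le′ = LiesAbove-pure (suc i) v le′

  pType⇒AboveLine : ∀ {s e N} g .{{_ : NonZero N}} → IsPType p g e → s * e ≤ N → AboveLine N s (s * e) g
  pType⇒AboveLine {s} {e} {N} g (degree , lead , low) se≤N k with <-cmp k e
  ... | tri≈ _ refl _ = liesAbove 0 (IsValℚ⇒ValAtLeast (coeff g k) lead) (m≤n+m (s * k) (N * 0))
  ... | tri> _ _ e<k = LiesAbove-resp (sym (proj₂ degree k e<k)) (LiesAbove-0ℚ s (s * e) k)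
  ... | tri< k<e _ _ with low k k<e
  ...   | inj₁ bₖ≡0 = LiesAbove-resp (sym bₖ≡0) (LiesAbove-0ℚ s (s * e) k)
  ...   | inj₂ (+ m , v , ℤ.+≤+ 1≤m) =
    liesAbove 1 (ValAtLeast-≤ 1≤m (IsValℚ⇒ValAtLeast (coeff g k) v))
      (≤-trans se≤N (≤-trans (≤-reflexive (sym (*-identityʳ N))) (m≤m+n (N * 1) (s * k))))

  AboveLine⇒pure-middle : ∀ {N r} h → AboveLine N r (r * N) h → ∀ k →
    coeff h k ≡ 0ℚ ⊎ Σ ℤ λ z → IsValℚ p (coeff h k) z × + r ℤ.* + (N ∸ k) ℤ.≤ + N ℤ.* z
  AboveLine⇒pure-middle {N} {r} h above k with coeff h k ℚ.≟ 0ℚ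
  ... | yes hₖ≡0 = inj₁ hₖ≡0
  ... | no hₖ≢0 with above k
  ...   | liesAbove m val le with ValAtLeast⇒IsValℚ hₖ≢0 val
  ...     | v , m≤v , exact = inj₂ (+ v , exact ,
    subst₂ ℤ._≤_ (ℤP.pos-* r (N ∸ k)) (ℤP.pos-* N v) (ℤ.+≤+ (begin
      r * (N ∸ k)             ≡⟨ *-distribˡ-∸ r N k ⟩
      r * N ∸ r * k           ≤⟨ ∸-monoˡ-≤ (r * k) le ⟩
      N * m + r * k ∸ r * k   ≡⟨ m+n∸n≡m (N * m) (r * k) ⟩
      N * m                   ≤⟨ *-monoʳ-≤ N m≤v ⟩
      N * v                   ∎)))
    where open ≤-Reasoning

  composition-leading : ∀ f g {d e} → 0 < e →
    HasDegree f d → IsValℚ p (coeff f d) (+ 0) → HasDegree g e → IsValℚ p (coeff g e) (+ 0) →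
    HasDegree (f ∘ₚ g) (d * e) × IsValℚ p (coeff (f ∘ₚ g) (d * e)) (+ 0)
  composition-leading f g {d} {e} 0<e degF unitF degG unitG =
    (IsValℚ⇒≢0 c unit ∘ trans (sym (coeff-top top)) , coeff-above top) ,
    subst (λ x → IsValℚ p x (+ 0)) (sym (coeff-top top)) unit
    where
    c = coeff f d ℚ.* coeff g e ^ᵠ d
    top : TopCoeff (f ∘ₚ g) (d * e) c
    top = TopCoeff-∘ f g 0<e (HasDegree⇒TopCoeff degF) (HasDegree⇒TopCoeff degG)
    unit : IsValℚ p c (+ 0)
    unit = IsValℚ-unit-* (coeff f d) (coeff g e ^ᵠ d) unitF (IsValℚ-unit-^ (coeff g e) unitG d)

  composition-constant : ∀ {r d e} f g .{{_ : NonZero d}} .{{_ : NonZero e}} →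
    r < d → IsPure p r f d → IsPType p g e → IsValℚ p (coeff (f ∘ₚ g) 0) (+ r)
  composition-constant [] g _ (_ , _ , const , _) _ = ⊥-elim (IsValℚ⇒≢0 0ℚ const refl)
  -- f ∘ g = a₀ + g·(as ∘ g). Steepening the line of the tail as from slope r·e to d·e before
  -- substituting g gains exactly the room (d > r) that pushes ν of the second summand above r.
  composition-constant {r} {d} {e} (a ∷ as) g r<d pure@(_ , _ , const , _) pType =
    subst (λ x → IsValℚ p x (+ r)) (sym (coeff-⊕ (a ∷ []) (g ⊗ (as ∘ₚ g)) 0))
      (IsValℚ-+-dominant a const
        (AboveLine⇒ValAtLeast₀ (g ⊗ (as ∘ₚ g)) aboveRest rde<de+[rde∸re]))
    where
    instance _ = m*n≢0 d e
    aboveG : AboveLine (d * e) d (d * e) g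
    aboveG = pType⇒AboveLine g pType ≤-refl
    aboveTail : AboveLine (d * e) (d * e) (r * d * e ∸ r * e) as
    aboveTail = AboveLine-steeper as (*-monoˡ-≤ e (<⇒≤ r<d))
                  (AboveLine-tail as (AboveLine-rescale (a ∷ as) e (pure⇒AboveLine (a ∷ as) pure)))
    aboveRest : AboveLine (d * e) d (d * e + (r * d * e ∸ r * e)) (g ⊗ (as ∘ₚ g))
    aboveRest = AboveLine-⊗ g (as ∘ₚ g) aboveG (AboveLine-∘ as g aboveG aboveTail)
    rde<de+[rde∸re] : d * e * r < d * e + (r * d * e ∸ r * e)
    rde<de+[rde∸re] = begin-strict
      d * e * r                         ≡⟨ *-comm (d * e) r ⟩
      r * (d * e)                       ≡⟨ *-assoc r d e ⟨
      r * d * e                         ≡⟨ m∸n+n≡m re≤rde ⟨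
      (r * d * e ∸ r * e) + r * e       <⟨ +-monoʳ-< (r * d * e ∸ r * e) (*-monoˡ-< e r<d) ⟩
      (r * d * e ∸ r * e) + d * e       ≡⟨ +-comm (r * d * e ∸ r * e) (d * e) ⟩
      d * e + (r * d * e ∸ r * e)       ∎
      where
      open ≤-Reasoning
      re≤rde : r * e ≤ r * d * e
      re≤rde = *-monoˡ-≤ e (m≤m*n r d)

  composition-middle : ∀ {r d e} f g .{{_ : NonZero d}} .{{_ : NonZero e}} →
    r < d → IsPure p r f d → IsPType p g e → ∀ k →
    coeff (f ∘ₚ g) k ≡ 0ℚ ⊎
    Σ ℤ λ z → IsValℚ p (coeff (f ∘ₚ g) k) z × + r ℤ.* + (d * e ∸ k) ℤ.≤ + (d * e) ℤ.* z
  composition-middle {r} {d} {e} f g r<d pure pType =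
    AboveLine⇒pure-middle {r = r} (f ∘ₚ g)
      (AboveLine-weaken (f ∘ₚ g) (≤-reflexive (sym (*-assoc r d e)))
        (AboveLine-∘ f g (pType⇒AboveLine g pType (*-monoˡ-≤ e (<⇒≤ r<d)))
          (AboveLine-rescale f e (pure⇒AboveLine f pure))))
    where instance _ = m*n≢0 d e

corollary3p8 : (p r : ℕ) → Prime p → 1 ≤ r →
  (f : Poly) (d : ℕ) → IsPure p r f d → r < d →
  (g : Poly) (e : ℕ) → 1 ≤ e → IsPType p g e →
  Σ ℕ λ n → IsPure p r (f ∘ₚ g) n
corollary3p8 p r p-prime _ f zero    _ () g e       _   _
corollary3p8 p r p-prime _ f (suc _) _ _  g zero    ()  _
corollary3p8 p r p-prime _ f d@(suc _) pure@(degF , unitF , _) r<d g e@(suc _) 0<e pType@(degG , unitG , _) =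
  let degree , leading = composition-leading p-prime f g 0<e degF unitF degG unitG
  in  d * e , degree , leading , composition-constant p-prime f g r<d pure pType ,
      λ k _ _ → composition-middle p-prime f g r<d pure pType k
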